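{- Let $R$ be a path. Then $\mathrm{sp}(R)$ and $\mathrm{ep}(R)$ are injective, i.e. $\mathrm{sp}(R)\mathbin{;}\mathrm{sp}(R)^{\top}\subseteq\mathsf{I}$ and $\mathrm{ep}(R)\mathbin{;}\mathrm{ep}(R)^{\top}\subseteq\mathsf{I}$.
   Context: $(B,\cup,\mathbin{;},\overline{\,\cdot\,},{}^{\top},{}^{*},\mathsf{I})$ is a Kleene relation algebra; all variables range over $B$. That is, $(B,\cup,\mathbin{;},\overline{\,\cdot\,},{}^{\top},\mathsf{I})$ is a relation algebra: $\cup$ is associative and commutative and $R=\overline{\overline{R}\cup\overline{S}}\cup\overline{\overline{R}\cup S}$; $\mathbin{;}$ is associative, $(R\cup S)\mathbin{;}T=R\mathbin{;}T\cup S\mathbin{;}T$, $R\mathbin{;}\mathsf{I}=R$; $(R^{\top})^{\top}=R$, $(R\cup S)^{\top}=R^{\top}\cup S^{\top}$, $(R\mathbin{;}S)^{\top}=S^{\top}\mathbin{;}R^{\top}$; $R^{\top}\mathbin{;}\overline{R\mathbin{;}S}\cup\overline{S}=\overline{S}$. The order is $R\subseteq S$ iff $R\cup S=S$; $R\cap S=\overline{\overline{R}\cup\overline{S}}$; $\mathsf{L}=R\cup\overline{R}$ is the greatest and $\mathsf{O}=R\cap\overline{R}$ the least element. The star satisfies $\mathsf{I}\cup R\mathbin{;}R^*\subseteq R^*$, $\mathsf{I}\cup R^*\mathbin{;}R\subseteq R^*$, $S\cup R\mathbin{;}Q\subseteq Q\Rightarrow R^*\mathbin{;}S\subseteq Q$,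 $S\cup Q\mathbin{;}R\subseteq Q\Rightarrow S\mathbin{;}R^*\subseteq Q$. Write $R^{\top*}=(R^{\top})^*$. The algebra satisfies the Tarski rule ($R\neq\mathsf{O}$ iff $\mathsf{L}\mathbin{;}R\mathbin{;}\mathsf{L}=\mathsf{L}$) and the point axiom (for every $R\neq\mathsf{O}$ there are points $p,q$ with $p\mathbin{;}q^{\top}\subseteq R$), where a point is an element $p$ with $p=p\mathbin{;}\mathsf{L}$, $p\mathbin{;}p^{\top}\subseteq\mathsf{I}$ and $\mathsf{I}\subseteq p^{\top}\mathbin{;}p$. Composition binds tighter than $\cup,\cap$; complement and converse bind tighter than composition. $R$ is univalent if $R^{\top}\mathbin{;}R\subseteq\mathsf{I}$ and injective if $R\mathbin{;}R^{\top}\subseteq\mathsf{I}$. $R$ is connected if $R\mathbin{;}\mathsf{L}\mathbin{;}R\subseteq R^*\cup R^{\top*}$; $R$ is a path if it is injective, univalent and connected. Start points: $\mathrm{sp}(R)=R\mathbin{;}\mathsf{L}\cap\overline{R^{\top}\mathbin{;}\mathsf{L}}$; end points: $\mathrm{ep}(R)=R^{\top}\mathbin{;}\mathsf{L}\cap\overline{R\mathbin{;}\mathsf{L}}$. -}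

module Defs where

open import Level using (Level; suc; _⊔_)
open import Relation.Binary.PropositionalEquality using (_≡_)
open import Relation.Nullary using (¬_)
open import Data.Product using (Σ; _×_; ∃-syntax)
open import Data.Sum using (_⊎_)

record KleeneRelationAlgebra (c : Level) : Set (suc c) where
  infixl 6 _∪_
  infixl 7 _⨟_
  infix 4 _⊆_
  infixl 6 _∩_
  infix 9 _ᵀ _*
  field
    B    : Set c
    _∪_  : B → B → B
    _⨟_  : B → B → B
    ∁    : B → B
    _ᵀ   : B → B
    _*   : B → B
    I    : B

  _⊆_ : B → B → Set c
  R ⊆ S = R ∪ S ≡ S

  _∩_ : B → B → B
  R ∩ S = ∁ (∁ R ∪ ∁ S)

  L : B
  L = I ∪ ∁ I

  O : B
  O = I ∩ ∁ I

  field
    ∪-assoc  : ∀ R S T → (R ∪ S) ∪ T ≡ R ∪ (S ∪ T)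
    ∪-comm   : ∀ R S → R ∪ S ≡ S ∪ R
    huntington : ∀ R S → R ≡ ∁ (∁ R ∪ ∁ S) ∪ ∁ (∁ R ∪ S)
    ⨟-assoc  : ∀ R S T → (R ⨟ S) ⨟ T ≡ R ⨟ (S ⨟ T)
    ⨟-distribʳ-∪ : ∀ R S T → (R ∪ S) ⨟ T ≡ R ⨟ T ∪ S ⨟ T
    ⨟-identityʳ : ∀ R → R ⨟ I ≡ R
    ᵀ-involutive : ∀ R → (R ᵀ) ᵀ ≡ R
    ᵀ-distrib-∪ : ∀ R S → (R ∪ S) ᵀ ≡ R ᵀ ∪ S ᵀ
    ᵀ-distrib-⨟ : ∀ R S → (R ⨟ S) ᵀ ≡ S ᵀ ⨟ R ᵀ
    schröder : ∀ R S → (R ᵀ) ⨟ ∁ (R ⨟ S) ∪ ∁ S ≡ ∁ S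
    star-unfoldˡ : ∀ R → I ∪ R ⨟ (R *) ⊆ R *
    star-unfoldʳ : ∀ R → I ∪ (R *) ⨟ R ⊆ R *
    star-inductˡ : ∀ R S Q → S ∪ R ⨟ Q ⊆ Q → (R *) ⨟ S ⊆ Q
    star-inductʳ : ∀ R S Q → S ∪ Q ⨟ R ⊆ Q → S ⨟ (R *) ⊆ Q

  IsPoint : B → Set c
  IsPoint p = (p ≡ p ⨟ L) × (p ⨟ (p ᵀ) ⊆ I) × (I ⊆ (p ᵀ) ⨟ p)

  field
    tarski : ∀ R → (¬ (R ≡ O) → L ⨟ R ⨟ L ≡ L) × (L ⨟ R ⨟ L ≡ L → ¬ (R ≡ O))
    point-axiom : ∀ R → ¬ (R ≡ O) →
      Σ B λ p → Σ B λ q → IsPoint p × IsPoint q × (p ⨟ (q ᵀ) ⊆ R)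

  Univalent : B → Set c
  Univalent R = (R ᵀ) ⨟ R ⊆ I

  Injective : B → Set c
  Injective R = R ⨟ (R ᵀ) ⊆ I

  Connected : B → Set c
  Connected R = R ⨟ L ⨟ R ⊆ (R *) ∪ ((R ᵀ) *)

  IsPath : B → Set c
  IsPath R = Injective R × Univalent R × Connected R

  sp : B → B
  sp R = R ⨟ L ∩ ∁ ((R ᵀ) ⨟ L)

  ep : B → B
  ep R = (R ᵀ) ⨟ L ∩ ∁ (R ⨟ L)

-- Write s = sp R and M = s ⨟ sᵀ ⨟ R, which relates every start point to every
-- successor of a start point; s ⨟ sᵀ ⊆ M ⨟ Rᵀ because start points have successors.
-- By connectivity M ⊆ R ⨟ L ⨟ R lies in R* ∪ Rᵀ*, and since start points have no
-- predecessor, M meets neither I nor Rᵀ ⨟ L ⊇ Rᵀ⁺. Hence M ⊆ R* ⨟ R and, R being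
-- injective, M ⨟ Rᵀ ⊆ R* ⊆ I ∪ L ⨟ R. As M ⨟ Rᵀ ⊆ L ⨟ sᵀ is disjoint from L ⨟ R,
-- M ⨟ Rᵀ ⊆ I. End points are the start points of Rᵀ.
module Submission where

open import Defs
open import Level using (Level)
open import Data.Product using (_×_; _,_)
open import Relation.Binary.PropositionalEquality
open import Relation.Binary.PropositionalEquality.Algebra using (isMagma)
open import Relation.Binary.Bundles using (Poset)
open import Relation.Binary.Structures using (IsPartialOrder)
open import Relation.Binary.Reasoning.Syntax using (module ⊆-syntax)
open import Algebra.Bundles using (CommutativeSemigroup)
import Algebra.Properties.CommutativeSemigroup as CommutativeSemigroupProperties

module KleeneRelationAlgebraProperties {c : Level} (K : KleeneRelationAlgebra c) where
  open KleeneRelationAlgebra K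

  ᵀ-I : I ᵀ ≡ I
  ᵀ-I = sym (begin
    I                ≡⟨ ᵀ-involutive I ⟨
    (I ᵀ) ᵀ          ≡⟨ cong _ᵀ (⨟-identityʳ (I ᵀ)) ⟨
    (I ᵀ ⨟ I) ᵀ      ≡⟨ ᵀ-distrib-⨟ (I ᵀ) I ⟩
    I ᵀ ⨟ (I ᵀ) ᵀ    ≡⟨ cong (I ᵀ ⨟_) (ᵀ-involutive I) ⟩
    I ᵀ ⨟ I          ≡⟨ ⨟-identityʳ (I ᵀ) ⟩
    I ᵀ              ∎)
    where open ≡-Reasoning

  ⨟-identityˡ : ∀ X → I ⨟ X ≡ X
  ⨟-identityˡ X = begin
    I ⨟ X              ≡⟨ ᵀ-involutive (I ⨟ X) ⟨
    ((I ⨟ X) ᵀ) ᵀ      ≡⟨ cong _ᵀ (ᵀ-distrib-⨟ I X) ⟩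
    (X ᵀ ⨟ I ᵀ) ᵀ      ≡⟨ cong (λ Y → (X ᵀ ⨟ Y) ᵀ) ᵀ-I ⟩
    (X ᵀ ⨟ I) ᵀ        ≡⟨ cong _ᵀ (⨟-identityʳ (X ᵀ)) ⟩
    (X ᵀ) ᵀ            ≡⟨ ᵀ-involutive X ⟩
    X                  ∎
    where open ≡-Reasoning

  ∪-commutativeSemigroup : CommutativeSemigroup c c
  ∪-commutativeSemigroup = record
    { isCommutativeSemigroup = record
      { isSemigroup = record { isMagma = isMagma _∪_ ; assoc = ∪-assoc }
      ; comm        = ∪-comm
      }
    }

  open CommutativeSemigroupProperties ∪-commutativeSemigroup using (interchange)

  -- Schröder's rule for R = I makes complements idempotent; Huntington's axiom
  -- writes every element as a join of two complements.
  ∪-idem-∁ : ∀ x → ∁ x ∪ ∁ x ≡ ∁ x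
  ∪-idem-∁ x = trans (cong (_∪ ∁ x) (sym I⨟∁[I⨟x]≡∁x)) (schröder I x)
    where
    I⨟∁[I⨟x]≡∁x : I ᵀ ⨟ ∁ (I ⨟ x) ≡ ∁ x
    I⨟∁[I⨟x]≡∁x rewrite ᵀ-I | ⨟-identityˡ x = ⨟-identityˡ (∁ x)

  ∪-idem : ∀ x → x ∪ x ≡ x
  ∪-idem x = begin
    x ∪ x                          ≡⟨ cong₂ _∪_ h h ⟩
    (a ∪ b) ∪ (a ∪ b)              ≡⟨ interchange a b a b ⟩
    (a ∪ a) ∪ (b ∪ b)              ≡⟨ cong₂ _∪_ (∪-idem-∁ _) (∪-idem-∁ _) ⟩
    a ∪ b                          ≡⟨ h ⟨
    x                              ∎
    where
    open ≡-Reasoning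
    a b : B
    a = ∁ (∁ x ∪ ∁ x)
    b = ∁ (∁ x ∪ x)
    h : x ≡ a ∪ b
    h = huntington x x

  ⊆-refl : ∀ {x} → x ⊆ x
  ⊆-refl {x} = ∪-idem x

  ⊆-reflexive : ∀ {x y} → x ≡ y → x ⊆ y
  ⊆-reflexive refl = ⊆-refl

  ⊆-trans : ∀ {x y z} → x ⊆ y → y ⊆ z → x ⊆ z
  ⊆-trans {x} {y} {z} p q = begin
    x ∪ z          ≡⟨ cong (x ∪_) q ⟨
    x ∪ (y ∪ z)    ≡⟨ ∪-assoc x y z ⟨
    (x ∪ y) ∪ z    ≡⟨ cong (_∪ z) p ⟩
    y ∪ z          ≡⟨ q ⟩
    z              ∎
    where open ≡-Reasoning

  ⊆-antisym : ∀ {x y} → x ⊆ y → y ⊆ x → x ≡ y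
  ⊆-antisym {x} {y} p q = trans (sym q) (trans (∪-comm y x) p)

  ⊆-isPartialOrder : IsPartialOrder _≡_ _⊆_
  ⊆-isPartialOrder = record
    { isPreorder = record
      { isEquivalence = isEquivalence
      ; reflexive     = ⊆-reflexive
      ; trans         = ⊆-trans
      }
    ; antisym = ⊆-antisym
    }

  ⊆-poset : Poset c c c
  ⊆-poset = record { isPartialOrder = ⊆-isPartialOrder }

  module ⊆-Reasoning where
    open import Relation.Binary.Reasoning.PartialOrder ⊆-poset public
    open ⊆-syntax _IsRelatedTo_ _IsRelatedTo_ ≤-go public

  x⊆x∪y : ∀ x y → x ⊆ x ∪ y
  x⊆x∪y x y = trans (sym (∪-assoc x x y)) (cong (_∪ y) (∪-idem x))

  y⊆x∪y : ∀ x y → y ⊆ x ∪ y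
  y⊆x∪y x y = subst (y ⊆_) (∪-comm y x) (x⊆x∪y y x)

  ∪-least : ∀ {x y z} → x ⊆ z → y ⊆ z → x ∪ y ⊆ z
  ∪-least {x} {y} {z} p q = trans (∪-assoc x y z) (trans (cong (x ∪_) q) p)

  ∪-mono : ∀ {x y u v} → x ⊆ y → u ⊆ v → x ∪ u ⊆ y ∪ v
  ∪-mono {y = y} {v = v} p q =
    ∪-least (⊆-trans p (x⊆x∪y y v)) (⊆-trans q (y⊆x∪y y v))

  ∁-swap : ∀ {x y} → ∁ x ⊆ y → ∁ y ⊆ x
  ∁-swap {x} {y} p = subst (λ z → ∁ z ⊆ x) p ∁[∁x∪y]⊆x
    where
    ∁[∁x∪y]⊆x : ∁ (∁ x ∪ y) ⊆ x
    ∁[∁x∪y]⊆x = subst (∁ (∁ x ∪ y) ⊆_) (sym (huntington x y)) (y⊆x∪y _ _)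

  ∁-involutive : ∀ x → ∁ (∁ x) ≡ x
  ∁-involutive x = ⊆-antisym (∁-swap ⊆-refl) x⊆∁∁x
    where
    x⊆∁∁x : x ⊆ ∁ (∁ x)
    x⊆∁∁x = subst (_⊆ ∁ (∁ x)) (sym (huntington x x))
      (∪-least (⊆-reflexive (cong ∁ (∪-idem (∁ x))))
               (∁-swap (⊆-trans (∁-swap ⊆-refl) (x⊆x∪y (∁ x) x))))

  ∁-antitone : ∀ {x y} → x ⊆ y → ∁ y ⊆ ∁ x
  ∁-antitone {x} {y} p = ∁-swap (subst (_⊆ y) (sym (∁-involutive x)) p)

  x⊆y∪∁y : ∀ x y → x ⊆ y ∪ ∁ y
  x⊆y∪∁y x y = subst (_⊆ y ∪ ∁ y) (sym (huntington x y))
    (∪-mono (∁-swap (y⊆x∪y (∁ x) (∁ y))) (∁-antitone (y⊆x∪y (∁ x) y)))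

  x⊆L : ∀ x → x ⊆ L
  x⊆L x = x⊆y∪∁y x I

  O⊆x : ∀ x → O ⊆ x
  O⊆x x = ∁-swap (x⊆y∪∁y (∁ x) (∁ I))

  ∁L⊆x : ∀ x → ∁ L ⊆ x
  ∁L⊆x x = ∁-swap (x⊆L (∁ x))

  x∩y⊆x : ∀ x y → x ∩ y ⊆ x
  x∩y⊆x x y = ∁-swap (x⊆x∪y (∁ x) (∁ y))

  x∩y⊆y : ∀ x y → x ∩ y ⊆ y
  x∩y⊆y x y = ∁-swap (y⊆x∪y (∁ x) (∁ y))

  ∩-greatest : ∀ {x y z} → z ⊆ x → z ⊆ y → z ⊆ x ∩ y
  ∩-greatest {z = z} p q =
    subst (_⊆ _) (∁-involutive z) (∁-antitone (∪-least (∁-antitone p) (∁-antitone q)))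

  ∩-mono : ∀ {x y u v} → x ⊆ y → u ⊆ v → x ∩ u ⊆ y ∩ v
  ∩-mono {x} {u = u} p q = ∩-greatest (⊆-trans (x∩y⊆x x u) p) (⊆-trans (x∩y⊆y x u) q)

  x∩∁x⊆y : ∀ x y → x ∩ ∁ x ⊆ y
  x∩∁x⊆y x y = ∁-swap (x⊆y∪∁y (∁ y) (∁ x))

  x⊆[x∩y]∪[x∩∁y] : ∀ x y → x ⊆ (x ∩ y) ∪ (x ∩ ∁ y)
  x⊆[x∩y]∪[x∩∁y] x y = ⊆-reflexive (trans (huntington x y)
    (cong (λ z → (x ∩ y) ∪ ∁ (∁ x ∪ z)) (sym (∁-involutive y))))

  ∁-distrib-∪ : ∀ x y → ∁ (x ∪ y) ≡ ∁ x ∩ ∁ y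
  ∁-distrib-∪ x y = sym (cong ∁ (cong₂ _∪_ (∁-involutive x) (∁-involutive y)))

  ∩-distribˡ-∪ : ∀ x y z → x ∩ (y ∪ z) ⊆ (x ∩ y) ∪ (x ∩ z)
  ∩-distribˡ-∪ x y z = ⊆-trans (x⊆[x∩y]∪[x∩∁y] w y)
    (∪-mono (∩-mono (x∩y⊆x x _) ⊆-refl) (∩-greatest (⊆-trans (x∩y⊆x w _) (x∩y⊆x x _)) w∩∁y⊆z))
    where
    w : B
    w = x ∩ (y ∪ z)
    w∩∁y∩∁z⊆z : (w ∩ ∁ y) ∩ ∁ z ⊆ z
    w∩∁y∩∁z⊆z = ⊆-trans
      (∩-greatest (⊆-trans (x∩y⊆x _ _) (⊆-trans (x∩y⊆x w _) (x∩y⊆y x _)))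
                  (subst ((w ∩ ∁ y) ∩ ∁ z ⊆_) (sym (∁-distrib-∪ y z)) (∩-mono (x∩y⊆y w _) ⊆-refl)))
      (x∩∁x⊆y (y ∪ z) z)
    w∩∁y⊆z : w ∩ ∁ y ⊆ z
    w∩∁y⊆z = ⊆-trans (x⊆[x∩y]∪[x∩∁y] (w ∩ ∁ y) z) (∪-least (x∩y⊆y _ _) w∩∁y∩∁z⊆z)

  ⊆-∪-disjointʳ : ∀ {x y z} → x ⊆ y ∪ z → x ∩ z ⊆ O → x ⊆ y
  ⊆-∪-disjointʳ {x} {y} {z} p q = begin
    x                   ⊆⟨ ∩-greatest ⊆-refl p ⟩
    x ∩ (y ∪ z)         ⊆⟨ ∩-distribˡ-∪ x y z ⟩
    (x ∩ y) ∪ (x ∩ z)   ⊆⟨ ∪-least (x∩y⊆y x y) (⊆-trans q (O⊆x y)) ⟩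
    y                   ∎
    where open ⊆-Reasoning

  ⊆-∪-disjointˡ : ∀ {x y z} → x ⊆ y ∪ z → x ∩ y ⊆ O → x ⊆ z
  ⊆-∪-disjointˡ {x} {y} {z} p = ⊆-∪-disjointʳ (subst (x ⊆_) (∪-comm y z) p)

  ᵀ-mono : ∀ {x y} → x ⊆ y → x ᵀ ⊆ y ᵀ
  ᵀ-mono {x} {y} p = trans (sym (ᵀ-distrib-∪ x y)) (cong _ᵀ p)

  ᵀ-⊆-swap : ∀ {x y} → x ᵀ ⊆ y → x ⊆ y ᵀ
  ᵀ-⊆-swap {x} p = subst (_⊆ _) (ᵀ-involutive x) (ᵀ-mono p)

  ᵀ-L : L ᵀ ≡ L
  ᵀ-L = ⊆-antisym (x⊆L (L ᵀ)) (ᵀ-⊆-swap (x⊆L (L ᵀ)))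

  ᵀ-O : O ᵀ ⊆ O
  ᵀ-O = subst (O ᵀ ⊆_) (ᵀ-involutive O) (ᵀ-mono (O⊆x (O ᵀ)))

  ᵀ-⨟-⊆O : ∀ {X Y} → X ⨟ Y ⊆ O → Y ᵀ ⨟ X ᵀ ⊆ O
  ᵀ-⨟-⊆O {X} {Y} p = subst (_⊆ O) (ᵀ-distrib-⨟ X Y) (⊆-trans (ᵀ-mono p) ᵀ-O)

  ᵀ-distrib-∩ : ∀ x y → (x ∩ y) ᵀ ≡ x ᵀ ∩ y ᵀ
  ᵀ-distrib-∩ x y = ⊆-antisym
    (∩-greatest (ᵀ-mono (x∩y⊆x x y)) (ᵀ-mono (x∩y⊆y x y)))
    (ᵀ-⊆-swap (∩-greatest (ᵀ-⊆-swap′ (x∩y⊆x (x ᵀ) (y ᵀ))) (ᵀ-⊆-swap′ (x∩y⊆y (x ᵀ) (y ᵀ)))))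
    where
    ᵀ-⊆-swap′ : ∀ {u v} → u ⊆ v ᵀ → u ᵀ ⊆ v
    ᵀ-⊆-swap′ {u} {v} p = subst (u ᵀ ⊆_) (ᵀ-involutive v) (ᵀ-mono p)

  ⨟-distribˡ-∪ : ∀ x y z → x ⨟ (y ∪ z) ≡ x ⨟ y ∪ x ⨟ z
  ⨟-distribˡ-∪ x y z = begin
    x ⨟ (y ∪ z)                        ≡⟨ ᵀ-involutive _ ⟨
    ((x ⨟ (y ∪ z)) ᵀ) ᵀ                ≡⟨ cong _ᵀ (ᵀ-distrib-⨟ x (y ∪ z)) ⟩
    ((y ∪ z) ᵀ ⨟ x ᵀ) ᵀ                ≡⟨ cong (λ u → (u ⨟ x ᵀ) ᵀ) (ᵀ-distrib-∪ y z) ⟩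
    ((y ᵀ ∪ z ᵀ) ⨟ x ᵀ) ᵀ              ≡⟨ cong _ᵀ (⨟-distribʳ-∪ (y ᵀ) (z ᵀ) (x ᵀ)) ⟩
    (y ᵀ ⨟ x ᵀ ∪ z ᵀ ⨟ x ᵀ) ᵀ          ≡⟨ ᵀ-distrib-∪ _ _ ⟩
    (y ᵀ ⨟ x ᵀ) ᵀ ∪ (z ᵀ ⨟ x ᵀ) ᵀ      ≡⟨ cong₂ _∪_ (untranspose y) (untranspose z) ⟩
    x ⨟ y ∪ x ⨟ z                      ∎
    where
    open ≡-Reasoning
    untranspose : ∀ u → (u ᵀ ⨟ x ᵀ) ᵀ ≡ x ⨟ u
    untranspose u = trans (cong _ᵀ (sym (ᵀ-distrib-⨟ x u))) (ᵀ-involutive (x ⨟ u))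

  ⨟-monoˡ : ∀ {x y} z → x ⊆ y → x ⨟ z ⊆ y ⨟ z
  ⨟-monoˡ {x} {y} z p = trans (sym (⨟-distribʳ-∪ x y z)) (cong (_⨟ z) p)

  ⨟-monoʳ : ∀ z {x y} → x ⊆ y → z ⨟ x ⊆ z ⨟ y
  ⨟-monoʳ z {x} {y} p = trans (sym (⨟-distribˡ-∪ z x y)) (cong (z ⨟_) p)

  ᵀ-⨟L : ∀ X → (X ⨟ L) ᵀ ≡ L ⨟ X ᵀ
  ᵀ-⨟L X = trans (ᵀ-distrib-⨟ X L) (cong (_⨟ X ᵀ) ᵀ-L)

  ᵀ-L⨟ : ∀ X → (L ⨟ X) ᵀ ≡ X ᵀ ⨟ L
  ᵀ-L⨟ X = trans (ᵀ-distrib-⨟ L X) (cong (X ᵀ ⨟_) ᵀ-L)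

  schröderᵀ : ∀ Q S → Q ⨟ ∁ (Q ᵀ ⨟ S) ⊆ ∁ S
  schröderᵀ Q S = subst (λ X → X ⨟ ∁ (Q ᵀ ⨟ S) ⊆ ∁ S) (ᵀ-involutive Q) (schröder (Q ᵀ) S)

  ⨟-∁[ᵀ⨟L]⊆O : ∀ X → X ⨟ ∁ (X ᵀ ⨟ L) ⊆ O
  ⨟-∁[ᵀ⨟L]⊆O X = ⊆-trans (schröderᵀ X L) (∁L⊆x O)

  ⨟-zeroʳ : ∀ X → X ⨟ O ⊆ O
  ⨟-zeroʳ X = ⊆-trans (⨟-monoʳ X (O⊆x _)) (⨟-∁[ᵀ⨟L]⊆O X)

  ⨟-zeroˡ : ∀ X → O ⨟ X ⊆ O
  ⨟-zeroˡ X = ⊆-trans (ᵀ-⊆-swap (begin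
    (O ⨟ X) ᵀ    ≡⟨ ᵀ-distrib-⨟ O X ⟩
    X ᵀ ⨟ O ᵀ    ⊆⟨ ⨟-monoʳ (X ᵀ) ᵀ-O ⟩
    X ᵀ ⨟ O      ⊆⟨ ⨟-zeroʳ (X ᵀ) ⟩
    O            ∎)) ᵀ-O
    where open ⊆-Reasoning

  dedekind : ∀ Q R S → Q ⨟ R ∩ S ⊆ Q ⨟ (R ∩ Q ᵀ ⨟ S)
  dedekind Q R S =
    ⊆-∪-disjointʳ (⊆-trans (x∩y⊆x _ S) Q⨟R⊆…∪∁S) (⊆-trans (∩-mono (x∩y⊆y _ S) ⊆-refl) (x∩∁x⊆y S O))
    where
    open ⊆-Reasoning
    Q⨟R⊆…∪∁S : Q ⨟ R ⊆ Q ⨟ (R ∩ Q ᵀ ⨟ S) ∪ ∁ S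
    Q⨟R⊆…∪∁S = begin
      Q ⨟ R                                        ⊆⟨ ⨟-monoʳ Q (x⊆[x∩y]∪[x∩∁y] R (Q ᵀ ⨟ S)) ⟩
      Q ⨟ ((R ∩ Q ᵀ ⨟ S) ∪ (R ∩ ∁ (Q ᵀ ⨟ S)))      ≡⟨ ⨟-distribˡ-∪ Q _ _ ⟩
      Q ⨟ (R ∩ Q ᵀ ⨟ S) ∪ Q ⨟ (R ∩ ∁ (Q ᵀ ⨟ S))    ⊆⟨ ∪-mono ⊆-refl (⨟-monoʳ Q (x∩y⊆y R _)) ⟩
      Q ⨟ (R ∩ Q ᵀ ⨟ S) ∪ Q ⨟ ∁ (Q ᵀ ⨟ S)          ⊆⟨ ∪-mono ⊆-refl (schröderᵀ Q S) ⟩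
      Q ⨟ (R ∩ Q ᵀ ⨟ S) ∪ ∁ S                      ∎

  ⨟L-∩ : ∀ X Y → X ⨟ L ∩ Y ⊆ X ⨟ (X ᵀ ⨟ Y)
  ⨟L-∩ X Y = ⊆-trans (dedekind X L Y) (⨟-monoʳ X (x∩y⊆y L _))

  L⨟-∩-I : ∀ X → L ⨟ X ∩ I ⊆ X ᵀ ⨟ X
  L⨟-∩-I X = ⊆-trans (ᵀ-⊆-swap (begin
    (L ⨟ X ∩ I) ᵀ          ≡⟨ ᵀ-distrib-∩ (L ⨟ X) I ⟩
    (L ⨟ X) ᵀ ∩ I ᵀ        ≡⟨ cong₂ _∩_ (ᵀ-L⨟ X) ᵀ-I ⟩
    X ᵀ ⨟ L ∩ I            ⊆⟨ ⨟L-∩ (X ᵀ) I ⟩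
    X ᵀ ⨟ ((X ᵀ) ᵀ ⨟ I)    ≡⟨ cong (X ᵀ ⨟_) (trans (⨟-identityʳ _) (ᵀ-involutive X)) ⟩
    X ᵀ ⨟ X                ∎)) (⊆-reflexive ᵀ[ᵀ⨟])
    where
    open ⊆-Reasoning
    ᵀ[ᵀ⨟] : (X ᵀ ⨟ X) ᵀ ≡ X ᵀ ⨟ X
    ᵀ[ᵀ⨟] = trans (ᵀ-distrib-⨟ (X ᵀ) X) (cong (X ᵀ ⨟_) (ᵀ-involutive X))

  ⨟L-disjoint : ∀ {X Y} → X ᵀ ⨟ Y ⊆ O → X ⨟ L ∩ Y ⨟ L ⊆ O
  ⨟L-disjoint {X} {Y} p = begin
    X ⨟ L ∩ Y ⨟ L              ⊆⟨ ⨟L-∩ X (Y ⨟ L) ⟩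
    X ⨟ (X ᵀ ⨟ (Y ⨟ L))        ≡⟨ cong (X ⨟_) (⨟-assoc (X ᵀ) Y L) ⟨
    X ⨟ (X ᵀ ⨟ Y ⨟ L)          ⊆⟨ ⨟-monoʳ X (⨟-monoˡ L p) ⟩
    X ⨟ (O ⨟ L)                ⊆⟨ ⨟-monoʳ X (⨟-zeroˡ L) ⟩
    X ⨟ O                      ⊆⟨ ⨟-zeroʳ X ⟩
    O                          ∎
    where open ⊆-Reasoning

  L⨟-disjoint : ∀ {X Y} → X ⨟ Y ᵀ ⊆ O → L ⨟ X ∩ L ⨟ Y ⊆ O
  L⨟-disjoint {X} {Y} p = ⊆-trans (ᵀ-⊆-swap (begin
    (L ⨟ X ∩ L ⨟ Y) ᵀ          ≡⟨ ᵀ-distrib-∩ (L ⨟ X) (L ⨟ Y) ⟩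
    (L ⨟ X) ᵀ ∩ (L ⨟ Y) ᵀ      ≡⟨ cong₂ _∩_ (ᵀ-L⨟ X) (ᵀ-L⨟ Y) ⟩
    X ᵀ ⨟ L ∩ Y ᵀ ⨟ L          ⊆⟨ ⨟L-disjoint (subst (λ Z → Z ⨟ Y ᵀ ⊆ O) (sym (ᵀ-involutive X)) p) ⟩
    O                          ∎)) ᵀ-O
    where open ⊆-Reasoning

  I⊆star : ∀ X → I ⊆ X *
  I⊆star X = ⊆-trans (x⊆x∪y I _) (star-unfoldˡ X)

  star⨟⊆star : ∀ X → X * ⨟ X ⊆ X *
  star⨟⊆star X = ⊆-trans (y⊆x∪y I _) (star-unfoldʳ X)

  star⊆I∪star⨟ : ∀ X → X * ⊆ I ∪ X * ⨟ X
  star⊆I∪star⨟ X = subst (_⊆ I ∪ X * ⨟ X) (⨟-identityˡ (X *)) (star-inductʳ X I _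
    (∪-mono ⊆-refl (subst (_⊆ X * ⨟ X) (sym (⨟-distribʳ-∪ I (X * ⨟ X) X))
      (∪-least (⨟-monoˡ X (I⊆star X)) (⨟-monoˡ X (star⨟⊆star X))))))

  star⊆I∪L⨟ : ∀ X → X * ⊆ I ∪ L ⨟ X
  star⊆I∪L⨟ X = subst (_⊆ I ∪ L ⨟ X) (⨟-identityˡ (X *))
    (star-inductʳ X I _ (∪-mono ⊆-refl (⨟-monoˡ X (x⊆L _))))

  star⊆I∪⨟L : ∀ X → X * ⊆ I ∪ X ⨟ L
  star⊆I∪⨟L X = subst (_⊆ I ∪ X ⨟ L) (⨟-identityʳ (X *))
    (star-inductˡ X I _ (∪-mono ⊆-refl (⨟-monoʳ X (x⊆L _))))

  ᵀ-star : ∀ X → (X *) ᵀ ⊆ (X ᵀ) *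
  ᵀ-star X = subst ((X *) ᵀ ⊆_) (ᵀ-involutive _)
    (ᵀ-mono (subst (_⊆ Q) (⨟-identityʳ (X *)) (star-inductˡ X I Q (∪-least I⊆Q X⨟Q⊆Q))))
    where
    Q : B
    Q = ((X ᵀ) *) ᵀ
    I⊆Q : I ⊆ Q
    I⊆Q = subst (_⊆ Q) ᵀ-I (ᵀ-mono (I⊆star (X ᵀ)))
    X⨟Q⊆Q : X ⨟ Q ⊆ Q
    X⨟Q⊆Q = subst (_⊆ Q) (trans (ᵀ-distrib-⨟ _ _) (cong (_⨟ Q) (ᵀ-involutive X)))
                         (ᵀ-mono (star⨟⊆star (X ᵀ)))

  ᵀ-injective : ∀ {R} → Univalent R → Injective (R ᵀ)
  ᵀ-injective {R} = subst (λ X → R ᵀ ⨟ X ⊆ I) (sym (ᵀ-involutive R))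

  ᵀ-connected : ∀ {R} → Connected R → Connected (R ᵀ)
  ᵀ-connected {R} con = begin
    R ᵀ ⨟ L ⨟ R ᵀ                   ≡⟨ ⨟-assoc (R ᵀ) L (R ᵀ) ⟩
    R ᵀ ⨟ (L ⨟ R ᵀ)                 ≡⟨ cong (R ᵀ ⨟_) (ᵀ-⨟L R) ⟨
    R ᵀ ⨟ (R ⨟ L) ᵀ                 ≡⟨ ᵀ-distrib-⨟ (R ⨟ L) R ⟨
    (R ⨟ L ⨟ R) ᵀ                   ⊆⟨ ᵀ-mono con ⟩
    (R * ∪ (R ᵀ) *) ᵀ               ≡⟨ ᵀ-distrib-∪ (R *) ((R ᵀ) *) ⟩
    (R *) ᵀ ∪ ((R ᵀ) *) ᵀ           ⊆⟨ ∪-mono (ᵀ-star R) (ᵀ-star (R ᵀ)) ⟩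
    (R ᵀ) * ∪ ((R ᵀ) ᵀ) *           ∎
    where open ⊆-Reasoning

  s⨟sᵀ⊆s⨟sᵀ⨟R⨟Rᵀ : ∀ {R s} → s ⊆ R ⨟ L → s ⨟ s ᵀ ⊆ s ⨟ s ᵀ ⨟ R ⨟ R ᵀ
  s⨟sᵀ⊆s⨟sᵀ⨟R⨟Rᵀ {R} {s} s⊆R⨟L = begin
    s ⨟ s ᵀ                      ⊆⟨ ⨟-monoʳ s (ᵀ-mono (⊆-trans (∩-greatest s⊆R⨟L ⊆-refl) (⨟L-∩ R s))) ⟩
    s ⨟ (R ⨟ (R ᵀ ⨟ s)) ᵀ        ≡⟨ cong (s ⨟_) (ᵀ-distrib-⨟ R _) ⟩
    s ⨟ ((R ᵀ ⨟ s) ᵀ ⨟ R ᵀ)      ≡⟨ cong (λ X → s ⨟ (X ⨟ R ᵀ)) (ᵀ-distrib-⨟ (R ᵀ) s) ⟩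
    s ⨟ (s ᵀ ⨟ (R ᵀ) ᵀ ⨟ R ᵀ)    ≡⟨ cong (λ X → s ⨟ (s ᵀ ⨟ X ⨟ R ᵀ)) (ᵀ-involutive R) ⟩
    s ⨟ (s ᵀ ⨟ R ⨟ R ᵀ)          ≡⟨ ⨟-assoc s _ _ ⟨
    s ⨟ (s ᵀ ⨟ R) ⨟ R ᵀ          ≡⟨ cong (_⨟ R ᵀ) (⨟-assoc s _ _) ⟨
    s ⨟ s ᵀ ⨟ R ⨟ R ᵀ            ∎
    where open ⊆-Reasoning

  s⨟sᵀ⨟R∩[I∪Rᵀ⨟L]⊆O : ∀ {R s} → R ⨟ s ⊆ O → s ⨟ s ᵀ ⨟ R ∩ (I ∪ R ᵀ ⨟ L) ⊆ O
  s⨟sᵀ⨟R∩[I∪Rᵀ⨟L]⊆O {R} {s} R⨟s⊆O = begin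
    M ∩ (I ∪ R ᵀ ⨟ L)    ⊆⟨ ∩-greatest (⊆-trans (x∩y⊆x M _) M⊆s⨟L)
                              (⊆-trans (∩-distribˡ-∪ M I _) (∪-least M∩I⊆Rᵀ⨟L (x∩y⊆y M _))) ⟩
    s ⨟ L ∩ R ᵀ ⨟ L      ⊆⟨ ⨟L-disjoint (ᵀ-⨟-⊆O R⨟s⊆O) ⟩
    O                    ∎
    where
    open ⊆-Reasoning
    M : B
    M = s ⨟ s ᵀ ⨟ R

    M⊆s⨟L : M ⊆ s ⨟ L
    M⊆s⨟L = subst (_⊆ s ⨟ L) (sym (⨟-assoc s (s ᵀ) R)) (⨟-monoʳ s (x⊆L _))

    M∩I⊆Rᵀ⨟L : M ∩ I ⊆ R ᵀ ⨟ L
    M∩I⊆Rᵀ⨟L = begin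
      M ∩ I         ⊆⟨ ∩-mono (⨟-monoˡ R (x⊆L _)) ⊆-refl ⟩
      L ⨟ R ∩ I     ⊆⟨ L⨟-∩-I R ⟩
      R ᵀ ⨟ R       ⊆⟨ ⨟-monoʳ (R ᵀ) (x⊆L R) ⟩
      R ᵀ ⨟ L       ∎

  -- The points of s have an R-successor but no R-predecessor; sp R is the
  -- largest such s.
  initial-injective : ∀ {R s} → Injective R → Connected R →
                      s ⊆ R ⨟ L → R ⨟ s ⊆ O → Injective s
  initial-injective {R} {s} inj con s⊆R⨟L R⨟s⊆O = begin
    s ⨟ s ᵀ      ⊆⟨ s⨟sᵀ⊆s⨟sᵀ⨟R⨟Rᵀ s⊆R⨟L ⟩
    M ⨟ R ᵀ      ⊆⟨ ⊆-∪-disjointʳ M⨟Rᵀ⊆I∪L⨟R M⨟Rᵀ∩L⨟R⊆O ⟩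
    I            ∎
    where
    open ⊆-Reasoning
    M : B
    M = s ⨟ s ᵀ ⨟ R

    M⊆R*∪Rᵀ* : M ⊆ R * ∪ (R ᵀ) *
    M⊆R*∪Rᵀ* = ⊆-trans (⨟-monoˡ R (⊆-trans (⨟-monoˡ (s ᵀ) s⊆R⨟L)
      (subst (_⊆ R ⨟ L) (sym (⨟-assoc R L (s ᵀ))) (⨟-monoʳ R (x⊆L _))))) con

    M⊆R*⨟R : M ⊆ R * ⨟ R
    M⊆R*⨟R = ⊆-∪-disjointˡ (⊆-trans M⊆R* (star⊆I∪star⨟ R))
      (⊆-trans (∩-mono ⊆-refl (x⊆x∪y I _)) (s⨟sᵀ⨟R∩[I∪Rᵀ⨟L]⊆O R⨟s⊆O))
      where
      M⊆R* : M ⊆ R *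
      M⊆R* = ⊆-∪-disjointʳ M⊆R*∪Rᵀ*
        (⊆-trans (∩-mono ⊆-refl (star⊆I∪⨟L (R ᵀ))) (s⨟sᵀ⨟R∩[I∪Rᵀ⨟L]⊆O R⨟s⊆O))

    M⨟Rᵀ⊆I∪L⨟R : M ⨟ R ᵀ ⊆ I ∪ L ⨟ R
    M⨟Rᵀ⊆I∪L⨟R = begin
      M ⨟ R ᵀ               ⊆⟨ ⨟-monoˡ (R ᵀ) M⊆R*⨟R ⟩
      R * ⨟ R ⨟ R ᵀ         ≡⟨ ⨟-assoc (R *) R (R ᵀ) ⟩
      R * ⨟ (R ⨟ R ᵀ)       ⊆⟨ ⨟-monoʳ (R *) inj ⟩
      R * ⨟ I               ≡⟨ ⨟-identityʳ (R *) ⟩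
      R *                   ⊆⟨ star⊆I∪L⨟ R ⟩
      I ∪ L ⨟ R             ∎

    M⨟Rᵀ∩L⨟R⊆O : M ⨟ R ᵀ ∩ L ⨟ R ⊆ O
    M⨟Rᵀ∩L⨟R⊆O = ⊆-trans (∩-mono M⨟Rᵀ⊆L⨟sᵀ ⊆-refl)
      (L⨟-disjoint (ᵀ-⨟-⊆O R⨟s⊆O))
      where
      M⨟Rᵀ⊆L⨟sᵀ : M ⨟ R ᵀ ⊆ L ⨟ s ᵀ
      M⨟Rᵀ⊆L⨟sᵀ = begin
        M ⨟ R ᵀ               ≡⟨ ⨟-assoc (s ⨟ s ᵀ) R (R ᵀ) ⟩
        s ⨟ s ᵀ ⨟ (R ⨟ R ᵀ)   ⊆⟨ ⨟-monoʳ (s ⨟ s ᵀ) inj ⟩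
        s ⨟ s ᵀ ⨟ I           ≡⟨ ⨟-identityʳ (s ⨟ s ᵀ) ⟩
        s ⨟ s ᵀ               ⊆⟨ ⨟-monoˡ (s ᵀ) (x⊆L s) ⟩
        L ⨟ s ᵀ               ∎

  sp-injective : ∀ {R} → Injective R → Connected R → Injective (sp R)
  sp-injective {R} inj con = initial-injective inj con (x∩y⊆x (R ⨟ L) _)
    (⊆-trans (⨟-monoʳ R (x∩y⊆y (R ⨟ L) _)) (⨟-∁[ᵀ⨟L]⊆O R))

  ep≡sp-ᵀ : ∀ R → ep R ≡ sp (R ᵀ)
  ep≡sp-ᵀ R = cong (λ X → R ᵀ ⨟ L ∩ ∁ (X ⨟ L)) (sym (ᵀ-involutive R))

  ep-injective : ∀ {R} → Univalent R → Connected R → Injective (ep R)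
  ep-injective {R} uni con =
    subst Injective (sym (ep≡sp-ᵀ R)) (sp-injective (ᵀ-injective uni) (ᵀ-connected con))

mainTheorem3 : ∀ {c : Level} (K : KleeneRelationAlgebra c) →
    let open KleeneRelationAlgebra K in
    ∀ (R : B) → IsPath R → Injective (sp R) × Injective (ep R)
mainTheorem3 K R (inj , uni , con) = sp-injective inj con , ep-injective uni con
  where open KleeneRelationAlgebraProperties K
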